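{- Let $n\ge 2$. Let $H_1,\dots,H_{2n-1}$ be $2n-1$ hyperplanes in general position in $n$-dimensional projective space (i.e.\ no $n+1$ of them have a common point). Let $\mathit{DCD}(n)$ be the point-line incidence structure whose points are the $\binom{2n-1}{n}$ points in which $n$ of these hyperplanes meet, whose lines are the $\binom{2n-1}{n-1}$ lines in which $n-1$ of these hyperplanes meet, with the incidence of projective space. Then $\mathit{DCD}(n)$ is isomorphic (as a combinatorial incidence structure) to the combinatorial configuration $N(O_n)$ obtained by $V$-construction from the Odd graph $O_n$.
   Context: The Kneser graph $K(m,k)$ has as vertices the $k$-element subsets of an $m$-element set, two vertices being adjacent iff the subsets are disjoint. The Odd graph is $O_n=K(2n-1,n-1)$. For a regular graph $G$ with vertex set $V(G)$, let $N(v)$ denote the set of neighbours of a vertex $v$. $G$ is called admissible if no two distinct vertices have the same neighbourhood. For an admissible regular graph $G$, the $V$-construction gives the combinatorial configuration $N(G)=(V(G),\{N(v): v\in V(G)\},\in)$, whose points are the vertices of $G$, whose blocks (lines) are the vertex-neighbourhoods, and incidence is membership. An isomorphism of incidence structures is a pair of bijections between points and between blocks/lines preserving incidence and non-incidence. -}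

module Defs where

open import Level using (Level; _⊔_) renaming (suc to lsuc)
open import Data.Nat using (ℕ; zero; suc) renaming (_*_ to _*ℕ_; _∸_ to _∸ℕ_)
open import Data.Fin using (Fin) renaming (zero to fzero; suc to fsuc)
open import Data.Fin.Subset using (Subset; _∈_; ∣_∣)
open import Data.Product using (Σ; ∃; _×_; _,_; proj₁)
open import Relation.Binary.PropositionalEquality using (_≡_)
open import Relation.Nullary using (¬_)
open import Function.Bundles using (_⇔_)
open import Algebra.Bundles using (CommutativeRing)

IsField : ∀ {c ℓ} → CommutativeRing c ℓ → Set (c ⊔ ℓ)
IsField R = (¬ (1# ≈ 0#)) × (∀ x → ¬ (x ≈ 0#) → ∃ λ y → (x * y) ≈ 1#)
  where open CommutativeRing R

-- Points and lines carry an equality relation (when points/lines are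
-- given by indices/representatives, two representatives may denote the
-- same point/line).

record IncStr (a b ℓ : Level) : Set (lsuc (a ⊔ b ⊔ ℓ)) where
  field
    Point  : Set a
    Line   : Set b
    _≈P_   : Point → Point → Set ℓ
    _≈L_   : Line → Line → Set ℓ
    _I_    : Point → Line → Set ℓ

record IsBij {a b ℓ₁ ℓ₂ : Level} {A : Set a} {B : Set b}
             (_≈₁_ : A → A → Set ℓ₁) (_≈₂_ : B → B → Set ℓ₂)
             (f : A → B) : Set (a ⊔ b ⊔ ℓ₁ ⊔ ℓ₂) where
  field
    cong  : ∀ {x y} → x ≈₁ y → f x ≈₂ f y
    inj   : ∀ {x y} → f x ≈₂ f y → x ≈₁ y
    surj  : ∀ y → ∃ λ x → f x ≈₂ y

record _≅_ {a b ℓ a' b' ℓ' : Level} (S : IncStr a b ℓ) (T : IncStr a' b' ℓ')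
       : Set (a ⊔ b ⊔ ℓ ⊔ a' ⊔ b' ⊔ ℓ') where
  private
    module S = IncStr S
    module T = IncStr T
  field
    φ      : S.Point → T.Point
    ψ      : S.Line → T.Line
    φ-bij  : IsBij S._≈P_ T._≈P_ φ
    ψ-bij  : IsBij S._≈L_ T._≈L_ ψ
    inc    : ∀ p L → (p S.I L) ⇔ (φ p T.I ψ L)

KSub : ℕ → ℕ → Set
KSub m k = Σ (Subset m) λ s → ∣ s ∣ ≡ k

KneserAdj : ∀ {m k} → KSub m k → KSub m k → Set
KneserAdj (s , _) (t , _) = ∀ i → ¬ (i ∈ s × i ∈ t)

record Graph : Set₁ where
  field
    V   : Set
    Adj : V → V → Set

Kneser : ℕ → ℕ → Graph
Kneser m k = record { V = KSub m k ; Adj = KneserAdj }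

Odd : ℕ → Graph
Odd n = Kneser (2 *ℕ n ∸ℕ 1) (n ∸ℕ 1)

Nbhd : (G : Graph) → Graph.V G → Graph.V G → Set
Nbhd G v u = Graph.Adj G v u

-- V-construction N(G): points = vertices (propositional equality),
-- lines = neighbourhoods N(v) (two lines equal iff the neighbourhoods
-- are equal as sets), incidence = membership u ∈ N(v).
NCon : (G : Graph) → IncStr Level.zero Level.zero Level.zero
NCon G = record
  { Point = V
  ; Line  = V
  ; _≈P_  = _≡_
  ; _≈L_  = λ v w → ∀ u → Nbhd G v u ⇔ Nbhd G w u
  ; _I_   = λ u v → Nbhd G v u
  }
  where open Graph G

-- A hyperplane is given by a (nonzero) linear form a ∈ F^(n+1); a vector
-- x lies on it iff Σ a_j x_j ≈ 0. Projective points are nonzero vectors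
-- up to scalars; the flats below are sets of vectors, closed under scalars.

module Projective {c ℓ} (R : CommutativeRing c ℓ) where
  open CommutativeRing R

  dot : ∀ {k} → (Fin k → Carrier) → (Fin k → Carrier) → Carrier
  dot {zero}  a x = 0#
  dot {suc k} a x = (a fzero * x fzero) + dot (λ i → a (fsuc i)) (λ i → x (fsuc i))

  IsZeroVec : ∀ {k} → (Fin k → Carrier) → Set ℓ
  IsZeroVec x = ∀ j → x j ≈ 0#

  Meet : ∀ {n m} → (Fin m → Fin (suc n) → Carrier) → Subset m
         → (Fin (suc n) → Carrier) → Set ℓ
  Meet H S x = ∀ i → i ∈ S → dot (H i) x ≈ 0#

  GeneralPosition : ∀ {n m} → (Fin m → Fin (suc n) → Carrier) → Set (c ⊔ ℓ)
  GeneralPosition {n} {m} H =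
    ∀ (S : Subset m) → ∣ S ∣ ≡ suc n → ∀ x → Meet H S x → IsZeroVec x

  -- DCD(n): points = the flats in which n of the hyperplanes meet,
  -- lines = the flats in which n-1 of them meet (indexed by the subset,
  -- two indices denoting the same point/line iff the flats coincide),
  -- incidence = containment of flats (incidence of projective space).
  DCD : (n : ℕ) → (Fin (2 *ℕ n ∸ℕ 1) → Fin (suc n) → Carrier)
        → IncStr Level.zero Level.zero (c ⊔ ℓ)
  DCD n H = record
    { Point = KSub (2 *ℕ n ∸ℕ 1) n
    ; Line  = KSub (2 *ℕ n ∸ℕ 1) (n ∸ℕ 1)
    ; _≈P_  = λ S S' → ∀ x → Meet H (proj₁ S) x ⇔ Meet H (proj₁ S') x
    ; _≈L_  = λ T T' → ∀ x → Meet H (proj₁ T) x ⇔ Meet H (proj₁ T') x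
    ; _I_   = λ S T → ∀ x → Meet H (proj₁ S) x → Meet H (proj₁ T) x
    }

-- A point of DCD(n) is the meet of n of the hyperplanes, a line the meet of n−1 of
-- them. In general position such a flat determines its index set s: if Hᵢ contains
-- the meet of s but i ∉ s, enlarge s, avoiding i, to n hyperplanes; their meet
-- contains a nonzero vector (n homogeneous equations in n+1 unknowns), which then
-- lies on n+1 hyperplanes. Consequently the point S lies on the line T iff T ⊆ S,
-- iff T is disjoint from the (n−1)-set ∁ S. So S ↦ ∁ S on points and T ↦ T on lines
-- is an isomorphism onto N(Oₙ), whose lines are faithfully indexed by the vertices
-- because distinct vertices of Oₙ have distinct neighbourhoods.
module Submission where

open import Defs
open import Data.Nat using (ℕ; zero; suc; _≤_; _<_; _∸_; s≤s; z≤n)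
import Data.Nat as ℕ
open import Data.Nat.Properties
  using (≡-irrelevant; <⇒≢; ≤-trans; ≤-pred; ≤-reflexive; n≤1+n; m≤n+m; +-suc;
         +-monoˡ-≤; m∸n+n≡m; m+n∸n≡m; m+n∸m≡n)
import Data.Nat.Properties as ℕₚ
open import Data.Fin using (Fin) renaming (zero to fzero; suc to fsuc)
open import Data.Fin.Properties using (¬∀⟶∃¬)
open import Data.Fin.Subset using (Subset; _∈_; _∉_; _⊆_; ∣_∣; ∁; _∪_; ⁅_⁆; inside; outside)
open import Data.Fin.Subset.Properties
  using (_∈?_; ∈⊤; ⊆-antisym; ∣⊤∣≡n; ∣∁p∣≡n∸∣p∣; ∪-identityʳ; p⊆p∪q;
         q⊆p∪q; x∈p∪q⁻; x∈⁅x⁆; x∈⁅y⁆⇒x≡y; x∉p⇒x∈∁p; x∈∁p⇒x∉p; x∉∁p⇒x∈p;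
         x∈p⇒x∉∁p; x∈p⇒∣p-x∣<∣p∣)
open import Data.Vec using ([]; _∷_; here; there)
open import Data.Vec.Functional as Vector using (Vector; head; tail)
open import Data.List using (List; []; _∷_; length; map)
open import Data.List.Properties using (length-map; length-removeAt′)
open import Data.List.Relation.Unary.All as All using (All; []; _∷_)
open import Data.List.Relation.Unary.All.Properties using (map⁻; ─⁻)
open import Data.List.Relation.Unary.Any as Any using (Any; here; there; _─_)
open import Data.List.Relation.Unary.Any.Properties using (lookup-result)
open import Data.Product using (∃; _×_; _,_; proj₁; proj₂)
open import Data.Sum using (_⊎_; inj₁; inj₂; [_,_]′)
import Data.Sum as Sum
open import Data.Empty using (⊥; ⊥-elim)
open import Function using (_∘_; id)
open import Function.Bundles using (_⇔_; mk⇔; Equivalence)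
open import Function.Construct.Composition using (_⇔-∘_)
open import Relation.Nullary using (¬_; yes; no; contradiction)
open import Relation.Nullary.Decidable using (¬¬-excluded-middle)
open import Relation.Nullary.Negation using (¬¬-map)
open import Relation.Binary.PropositionalEquality
  using (_≡_; _≢_; refl; sym; trans; cong; subst)
open import Algebra.Bundles using (CommutativeRing)

¬¬-All⊎Any¬ : ∀ {a p} {A : Set a} {P : A → Set p} (xs : List A) →
              ¬ ¬ (All P xs ⊎ Any (¬_ ∘ P) xs)
¬¬-All⊎Any¬ []       k = k (inj₁ [])
¬¬-All⊎Any¬ (x ∷ xs) k = ¬¬-excluded-middle λ where
  (no ¬px) → k (inj₂ (here ¬px))
  (yes px) → ¬¬-All⊎Any¬ xs λ where
    (inj₁ all) → k (inj₁ (px ∷ all))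
    (inj₂ any) → k (inj₂ (there any))

select : ∀ {m a} {A : Set a} → (Fin m → A) → Subset m → List A
select f []            = []
select f (inside  ∷ s) = f fzero ∷ select (f ∘ fsuc) s
select f (outside ∷ s) = select (f ∘ fsuc) s

length-select : ∀ {m a} {A : Set a} (f : Fin m → A) s → length (select f s) ≡ ∣ s ∣
length-select f []            = refl
length-select f (inside  ∷ s) = cong suc (length-select (f ∘ fsuc) s)
length-select f (outside ∷ s) = length-select (f ∘ fsuc) s

All-select⁻ : ∀ {m a p} {A : Set a} {P : A → Set p} (f : Fin m → A) s →
              All P (select f s) → ∀ i → i ∈ s → P (f i)
All-select⁻ f (inside  ∷ s) (px ∷ _)  fzero    here        = px
All-select⁻ f (inside  ∷ s) (_ ∷ pxs) (fsuc i) (there i∈s) = All-select⁻ (f ∘ fsuc) s pxs i i∈s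
All-select⁻ f (outside ∷ s) pxs       (fsuc i) (there i∈s) = All-select⁻ (f ∘ fsuc) s pxs i i∈s

∣p∪⁅x⁆∣≡1+∣p∣ : ∀ {m} {x : Fin m} {p : Subset m} → x ∉ p → ∣ p ∪ ⁅ x ⁆ ∣ ≡ suc ∣ p ∣
∣p∪⁅x⁆∣≡1+∣p∣ {x = fzero} {p = outside ∷ p} x∉p = cong (suc ∘ ∣_∣) (∪-identityʳ p)
∣p∪⁅x⁆∣≡1+∣p∣ {x = fzero} {p = inside  ∷ p} x∉p = contradiction here x∉p
∣p∪⁅x⁆∣≡1+∣p∣ {x = fsuc x} {p = outside ∷ p} x∉p = ∣p∪⁅x⁆∣≡1+∣p∣ (x∉p ∘ there)
∣p∪⁅x⁆∣≡1+∣p∣ {x = fsuc x} {p = inside  ∷ p} x∉p = cong suc (∣p∪⁅x⁆∣≡1+∣p∣ (x∉p ∘ there))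

x∈p∪⁅y⁆⇒x∈p⊎x≡y : ∀ {m} {x y : Fin m} {p : Subset m} → x ∈ p ∪ ⁅ y ⁆ → x ∈ p ⊎ x ≡ y
x∈p∪⁅y⁆⇒x∈p⊎x≡y {y = y} {p} = Sum.map₂ (x∈⁅y⁆⇒x≡y y) ∘ x∈p∪q⁻ p ⁅ y ⁆

x∉p∪⁅y⁆⇒y≢x : ∀ {m} {x y : Fin m} {p : Subset m} → x ∉ p ∪ ⁅ y ⁆ → y ≢ x
x∉p∪⁅y⁆⇒y≢x {p = p} x∉p∪⁅y⁆ refl = x∉p∪⁅y⁆ (q⊆p∪q p _ (x∈⁅x⁆ _))

∣p∣<n⇒∃∉ : ∀ {m} (p : Subset m) → ∣ p ∣ < m → ∃ λ x → x ∉ p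
∣p∣<n⇒∃∉ {m} p ∣p∣<m = ¬∀⟶∃¬ m (_∈ p) (_∈? p) λ all∈p →
  <⇒≢ ∣p∣<m (trans (cong ∣_∣ (⊆-antisym (λ _ → ∈⊤) (λ {x} _ → all∈p x))) (∣⊤∣≡n m))

∁-involutive : ∀ {m} (p : Subset m) → ∁ (∁ p) ≡ p
∁-involutive p = ⊆-antisym (x∉∁p⇒x∈p ∘ x∈∁p⇒x∉p) (x∉p⇒x∈∁p ∘ x∈p⇒x∉∁p)

∁-injective : ∀ {m} {p q : Subset m} → ∁ p ≡ ∁ q → p ≡ q
∁-injective {p = p} {q} ∁p≡∁q = trans (sym (∁-involutive p)) (trans (cong ∁ ∁p≡∁q) (∁-involutive q))

⊆⇔disjoint-∁ : ∀ {m} {p q : Subset m} → q ⊆ p ⇔ (∀ i → ¬ (i ∈ q × i ∈ ∁ p))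
⊆⇔disjoint-∁ = mk⇔
  (λ q⊆p i (i∈q , i∈∁p) → x∈∁p⇒x∉p i∈∁p (q⊆p i∈q))
  (λ disjoint {i} i∈q → x∉∁p⇒x∈p (λ i∈∁p → disjoint i (i∈q , i∈∁p)))

KSub-≡ : ∀ {m k} {s t : KSub m k} → proj₁ s ≡ proj₁ t → s ≡ t
KSub-≡ {s = s , p} {.s , q} refl = cong (s ,_) (≡-irrelevant p q)

KSub-∁ : ∀ {m k l} → m ∸ k ≡ l → KSub m k → KSub m l
KSub-∁ {m} m∸k≡l (s , ∣s∣≡k) = ∁ s , trans (∣∁p∣≡n∸∣p∣ s) (trans (cong (m ∸_) ∣s∣≡k) m∸k≡l)

KneserAdj-congˡ : ∀ {m k} {t t′ : KSub m k} → proj₁ t ≡ proj₁ t′ →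
                  ∀ u → KneserAdj t u ⇔ KneserAdj t′ u
KneserAdj-congˡ {t = t , _} {.t , _} refl u = mk⇔ id id

-- Given i ∈ t ∖ t′, the k-set u = ∁ (t′ ∪ {j}), for some j ∉ t′ ∪ {i}, is adjacent to t′ but not to t.
Odd-nbhd⊆⇒⊇ : ∀ {m k} → m ≡ k ℕ.+ suc k → (t t′ : KSub m k) →
              (∀ u → KneserAdj t′ u → KneserAdj t u) → proj₁ t ⊆ proj₁ t′
Odd-nbhd⊆⇒⊇ {m} {k} m≡k+[1+k] (t , ∣t∣≡k) (t′ , ∣t′∣≡k) N[t′]⊆N[t] {i} i∈t with i ∈? t′
... | yes i∈t′ = i∈t′
... | no  i∉t′ with ∣p∣<n⇒∃∉ (t′ ∪ ⁅ i ⁆) ∣t′∪⁅i⁆∣<m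
  where
  ∣t′∪⁅i⁆∣<m : ∣ t′ ∪ ⁅ i ⁆ ∣ < m
  ∣t′∪⁅i⁆∣<m = begin-strict
    ∣ t′ ∪ ⁅ i ⁆ ∣  ≡⟨ ∣p∪⁅x⁆∣≡1+∣p∣ i∉t′ ⟩
    suc ∣ t′ ∣      ≡⟨ cong suc ∣t′∣≡k ⟩
    suc k          <⟨ +-monoˡ-≤ (suc k) 1≤k ⟩
    k ℕ.+ suc k    ≡⟨ m≡k+[1+k] ⟨
    m              ∎
    where
    open ℕₚ.≤-Reasoning
    1≤k : 1 ≤ k
    1≤k = subst (1 ≤_) ∣t∣≡k (≤-trans (s≤s z≤n) (x∈p⇒∣p-x∣<∣p∣ i∈t))
... | j , j∉t′∪⁅i⁆ = contradiction (i∈t , i∈u) (N[t′]⊆N[t] u t′⊥u i)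
  where
  j∉t′ : j ∉ t′
  j∉t′ = j∉t′∪⁅i⁆ ∘ p⊆p∪q _
  u : KSub m k
  u = KSub-∁ (trans (cong (_∸ suc k) m≡k+[1+k]) (m+n∸n≡m k (suc k)))
             (t′ ∪ ⁅ j ⁆ , trans (∣p∪⁅x⁆∣≡1+∣p∣ j∉t′) (cong suc ∣t′∣≡k))
  t′⊥u : KneserAdj (t′ , ∣t′∣≡k) u
  t′⊥u l (l∈t′ , l∈u) = x∈∁p⇒x∉p l∈u (p⊆p∪q _ l∈t′)
  i∈u : i ∈ proj₁ u
  i∈u = x∉p⇒x∈∁p ([ i∉t′ , x∉p∪⁅y⁆⇒y≢x j∉t′∪⁅i⁆ ]′ ∘ x∈p∪⁅y⁆⇒x∈p⊎x≡y)

module LinearAlgebra {c ℓ} (F : CommutativeRing c ℓ) (isField : IsField F) where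
  open CommutativeRing F renaming (refl to ≈-refl; sym to ≈-sym; trans to ≈-trans)
  open Projective F
  open import Algebra.Properties.Ring ring using (-‿distribʳ-*; -1*x≈-x)
  open import Algebra.Solver.Ring.NaturalCoefficients.Default commutativeSemiring
  open import Relation.Binary.Reasoning.Setoid setoid

  dot-zeroʳ : ∀ {k} (a : Vector Carrier k) → dot a (λ _ → 0#) ≈ 0#
  dot-zeroʳ {zero}  a = ≈-refl
  dot-zeroʳ {suc k} a = begin
    head a * 0# + dot (tail a) (λ _ → 0#) ≈⟨ +-cong (zeroʳ _) (dot-zeroʳ (tail a)) ⟩
    0# + 0#                                ≈⟨ +-identityʳ 0# ⟩
    0#                                     ∎

  dot-linearˡ : ∀ {k} (u v y : Vector Carrier k) r →
                dot (λ j → u j + r * v j) y ≈ dot u y + r * dot v y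
  dot-linearˡ {zero}  u v y r = ≈-sym (≈-trans (+-congˡ (zeroʳ r)) (+-identityʳ 0#))
  dot-linearˡ {suc k} u v y r =
    ≈-trans (+-congˡ (dot-linearˡ (tail u) (tail v) (tail y) r))
          (solve 6 (λ u₀ v₀ y₀ r U V → (u₀ :+ r :* v₀) :* y₀ :+ (U :+ r :* V)
                                    := (u₀ :* y₀ :+ U) :+ r :* (v₀ :* y₀ :+ V))
                   ≈-refl (head u) (head v) (head y) r (dot (tail u) (tail y)) (dot (tail v) (tail y)))

  e₀ : ∀ {k} → Vector Carrier (suc k)
  e₀ = 1# Vector.∷ λ _ → 0#

  e₀-nonzero : ∀ {k} → ¬ IsZeroVec (e₀ {k})
  e₀-nonzero e₀≈0 = proj₁ isField (e₀≈0 fzero)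

  dot-e₀ : ∀ {k} (a : Vector Carrier (suc k)) → head a ≈ 0# → dot a e₀ ≈ 0#
  dot-e₀ a a₀≈0 = begin
    head a * 1# + dot (tail a) (λ _ → 0#) ≈⟨ +-cong (*-identityʳ _) (dot-zeroʳ (tail a)) ⟩
    head a + 0#                           ≈⟨ +-identityʳ _ ⟩
    head a                                ≈⟨ a₀≈0 ⟩
    0#                                    ∎

  module Pivot {k} (p : Vector Carrier (suc (suc k))) (c : Carrier) (p₀c≈1 : head p * c ≈ 1#) where

    eliminate : Vector Carrier (suc (suc k)) → Vector Carrier (suc k)
    eliminate a j = tail a j + (head a * - c) * tail p j

    back-substitute : Vector Carrier (suc k) → Vector Carrier (suc (suc k))
    back-substitute y = (- c) * dot (tail p) y Vector.∷ y

    dot-back-substitute : ∀ a y → dot a (back-substitute y) ≈ dot (eliminate a) y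
    dot-back-substitute a y = begin
      head a * (- c * D) + dot (tail a) y ≈⟨ solve 4 (λ a₀ r D T → a₀ :* (r :* D) :+ T := T :+ (a₀ :* r) :* D)
                                                   ≈-refl (head a) (- c) D (dot (tail a) y) ⟩
      dot (tail a) y + (head a * - c) * D ≈⟨ ≈-sym (dot-linearˡ (tail a) (tail p) y _) ⟩
      dot (eliminate a) y                 ∎
      where D = dot (tail p) y

    dot-pivot-back-substitute : ∀ y → dot p (back-substitute y) ≈ 0#
    dot-pivot-back-substitute y = begin
      dot p (back-substitute y) ≈⟨ dot-back-substitute p y ⟩
      dot (eliminate p) y       ≈⟨ dot-linearˡ (tail p) (tail p) y _ ⟩
      D + (head p * - c) * D    ≈⟨ +-congˡ (*-congʳ (≈-trans (≈-sym (-‿distribʳ-* _ _)) (-‿cong p₀c≈1))) ⟩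
      D + (- 1#) * D            ≈⟨ +-congˡ (-1*x≈-x D) ⟩
      D + - D                   ≈⟨ -‿inverseʳ D ⟩
      0#                        ∎
      where D = dot (tail p) y

  -- Equality in a field is not decidable, so only the double negation of the
  -- existence of a solution is available.
  homogeneous-nontrivial : ∀ k (L : List (Vector Carrier (suc k))) → length L ≤ k →
    ¬ ¬ (∃ λ x → All (λ a → dot a x ≈ 0#) L × ¬ IsZeroVec x)
  homogeneous-nontrivial zero    [] _   none = none (e₀ , [] , e₀-nonzero)
  homogeneous-nontrivial (suc k) L  len none = ¬¬-All⊎Any¬ L [ heads-zero , pivoting ]′
    where
    heads-zero : All (λ a → head a ≈ 0#) L → ⊥
    heads-zero heads≈0 = none (e₀ , All.map (λ {a} → dot-e₀ a) heads≈0 , e₀-nonzero)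

    pivoting : Any (λ a → ¬ head a ≈ 0#) L → ⊥
    pivoting pivot with proj₂ isField (head (Any.lookup pivot)) (lookup-result pivot)
    ... | c , p₀c≈1 = homogeneous-nontrivial k (map eliminate rest) length≤k lift
      where
      open Pivot (Any.lookup pivot) c p₀c≈1
      rest = L ─ pivot
      length≤k : length (map eliminate rest) ≤ k
      length≤k = ≤-pred (subst (_≤ suc k)
        (trans (length-removeAt′ L (Any.index pivot)) (cong suc (sym (length-map eliminate rest)))) len)
      lift : ¬ (∃ λ y → All (λ a → dot a y ≈ 0#) (map eliminate rest) × ¬ IsZeroVec y)
      lift (y , solved , y≉0) = none
        ( back-substitute y
        , ─⁻ pivot (dot-pivot-back-substitute y) (All.map (λ {a} → ≈-trans (dot-back-substitute a y)) (map⁻ solved))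
        , λ x≈0 → y≉0 (x≈0 ∘ fsuc))

module Arrangement {c ℓ} (F : CommutativeRing c ℓ) (isField : IsField F) {n m : ℕ}
  (H : Fin m → Vector (CommutativeRing.Carrier F) (suc n))
  (general : Projective.GeneralPosition F H) (n<m : n < m) where
  open CommutativeRing F using (_≈_; 0#)
  open Projective F
  open LinearAlgebra F isField using (homogeneous-nontrivial)

  Meet-antitone : ∀ {s t : Subset m} → t ⊆ s → ∀ x → Meet H s x → Meet H t x
  Meet-antitone t⊆s x x∈s i i∈t = x∈s i (t⊆s i∈t)

  Meet-∪⁅⁆ : ∀ {s : Subset m} {i} x → Meet H s x → dot (H i) x ≈ 0# → Meet H (s ∪ ⁅ i ⁆) x
  Meet-∪⁅⁆ x x∈s x∈Hᵢ j j∈s∪⁅i⁆ with x∈p∪⁅y⁆⇒x∈p⊎x≡y j∈s∪⁅i⁆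
  ... | inj₁ j∈s = x∈s j j∈s
  ... | inj₂ refl = x∈Hᵢ

  Meet-nontrivial : ∀ (s : Subset m) → ∣ s ∣ ≤ n → ¬ ¬ (∃ λ x → Meet H s x × ¬ IsZeroVec x)
  Meet-nontrivial s ∣s∣≤n =
    ¬¬-map (λ (x , solved , x≉0) → x , All-select⁻ H s solved , x≉0)
           (homogeneous-nontrivial n (select H s) (subst (_≤ n) (sym (length-select H s)) ∣s∣≤n))

  Meet⊆Hᵢ⇒∈ : ∀ {i} d (s : Subset m) → d ℕ.+ ∣ s ∣ ≡ n →
              (∀ x → Meet H s x → dot (H i) x ≈ 0#) → i ∈ s
  Meet⊆Hᵢ⇒∈ {i} d s _ _ with i ∈? s
  ... | yes i∈s = i∈s
  Meet⊆Hᵢ⇒∈ {i} zero s ∣s∣≡n Meet⊆Hᵢ | no i∉s =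
    ⊥-elim (Meet-nontrivial s (≤-reflexive ∣s∣≡n) λ (x , x∈s , x≉0) →
      x≉0 (general (s ∪ ⁅ i ⁆) (trans (∣p∪⁅x⁆∣≡1+∣p∣ i∉s) (cong suc ∣s∣≡n)) x
                   (Meet-∪⁅⁆ x x∈s (Meet⊆Hᵢ x x∈s))))
  Meet⊆Hᵢ⇒∈ {i} (suc d) s d+∣s∣≡n Meet⊆Hᵢ | no i∉s with ∣p∣<n⇒∃∉ (s ∪ ⁅ i ⁆) ∣s∪⁅i⁆∣<m
    where
    ∣s∪⁅i⁆∣<m : ∣ s ∪ ⁅ i ⁆ ∣ < m
    ∣s∪⁅i⁆∣<m = begin-strict
      ∣ s ∪ ⁅ i ⁆ ∣    ≡⟨ ∣p∪⁅x⁆∣≡1+∣p∣ i∉s ⟩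
      suc ∣ s ∣        ≤⟨ s≤s (m≤n+m ∣ s ∣ d) ⟩
      suc d ℕ.+ ∣ s ∣  ≡⟨ d+∣s∣≡n ⟩
      n                <⟨ n<m ⟩
      m                ∎
      where open ℕₚ.≤-Reasoning
  ... | j , j∉s∪⁅i⁆ =
    ⊥-elim ([ i∉s , x∉p∪⁅y⁆⇒y≢x j∉s∪⁅i⁆ ]′ (x∈p∪⁅y⁆⇒x∈p⊎x≡y
      (Meet⊆Hᵢ⇒∈ d (s ∪ ⁅ j ⁆) (trans (trans (cong (d ℕ.+_) (∣p∪⁅x⁆∣≡1+∣p∣ (j∉s∪⁅i⁆ ∘ p⊆p∪q _))) (+-suc d ∣ s ∣)) d+∣s∣≡n)
                 (λ x → Meet⊆Hᵢ x ∘ Meet-antitone (p⊆p∪q _) x))))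

  Meet⊆Meet⇔⊇ : ∀ {s t : Subset m} → ∣ s ∣ ≤ n → (∀ x → Meet H s x → Meet H t x) ⇔ t ⊆ s
  Meet⊆Meet⇔⊇ {s} {t} ∣s∣≤n = mk⇔ ⊇ Meet-antitone
    where
    ⊇ : (∀ x → Meet H s x → Meet H t x) → t ⊆ s
    ⊇ Meet[s]⊆Meet[t] i∈t = Meet⊆Hᵢ⇒∈ (n ∸ ∣ s ∣) s (m∸n+n≡m ∣s∣≤n) λ x x∈s → Meet[s]⊆Meet[t] x x∈s _ i∈t

  Meet-injective : ∀ {s t : Subset m} → ∣ s ∣ ≤ n → ∣ t ∣ ≤ n →
                   (∀ x → Meet H s x ⇔ Meet H t x) → s ≡ t
  Meet-injective ∣s∣≤n ∣t∣≤n Meet[s]≐Meet[t] = ⊆-antisym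
    (Equivalence.to (Meet⊆Meet⇔⊇ ∣t∣≤n) (Equivalence.from ∘ Meet[s]≐Meet[t]))
    (Equivalence.to (Meet⊆Meet⇔⊇ ∣s∣≤n) (Equivalence.to ∘ Meet[s]≐Meet[t]))

  Meet-cong : ∀ {s t : Subset m} → s ≡ t → ∀ x → Meet H s x ⇔ Meet H t x
  Meet-cong refl x = mk⇔ id id

2[1+k]∸1≡k+[1+k] : ∀ k → 2 ℕ.* suc k ∸ 1 ≡ k ℕ.+ suc k
2[1+k]∸1≡k+[1+k] k = cong (k ℕ.+_) (cong suc (ℕₚ.+-identityʳ k))

module DCD≅NOdd {c ℓ} (F : CommutativeRing c ℓ) (isField : IsField F) (k : ℕ) (1≤k : 1 ≤ k)
  (H : Fin (2 ℕ.* suc k ∸ 1) → Vector (CommutativeRing.Carrier F) (suc (suc k)))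
  (general : Projective.GeneralPosition F H) where

  private
    m≡k+[1+k] : 2 ℕ.* suc k ∸ 1 ≡ k ℕ.+ suc k
    m≡k+[1+k] = 2[1+k]∸1≡k+[1+k] k

    suc-k<m : suc k < 2 ℕ.* suc k ∸ 1
    suc-k<m = subst (suc (suc k) ≤_) (sym m≡k+[1+k]) (+-monoˡ-≤ (suc k) 1≤k)

    module D = IncStr (Projective.DCD F (suc k) H)
    module N = IncStr (NCon (Odd (suc k)))
    open Arrangement F isField H general suc-k<m

    point-size≤ : ∀ (S : D.Point) → ∣ proj₁ S ∣ ≤ suc k
    point-size≤ S = ≤-reflexive (proj₂ S)

    line-size≤ : ∀ (T : D.Line) → ∣ proj₁ T ∣ ≤ suc k
    line-size≤ T = ≤-trans (≤-reflexive (proj₂ T)) (n≤1+n k)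

  φ : D.Point → N.Point
  φ = KSub-∁ (trans (cong (_∸ suc k) m≡k+[1+k]) (m+n∸n≡m k (suc k)))

  φ-bij : IsBij D._≈P_ N._≈P_ φ
  φ-bij = record
    { cong = λ {S} {S′} S≐S′ → KSub-≡ (cong ∁ (Meet-injective (point-size≤ S) (point-size≤ S′) S≐S′))
    ; inj  = λ φS≡φS′ → Meet-cong (∁-injective (cong proj₁ φS≡φS′))
    ; surj = λ T → KSub-∁ (trans (cong (_∸ k) m≡k+[1+k]) (m+n∸m≡n k (suc k))) T
                 , KSub-≡ (∁-involutive (proj₁ T))
    }

  ψ-bij : IsBij D._≈L_ N._≈L_ id
  ψ-bij = record
    { cong = λ {T} {T′} T≐T′ → KneserAdj-congˡ {t = T} {T′} (Meet-injective (line-size≤ T) (line-size≤ T′) T≐T′)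
    ; inj  = λ {T} {T′} N[T]≐N[T′] → Meet-cong (⊆-antisym
               (Odd-nbhd⊆⇒⊇ m≡k+[1+k] T T′ (Equivalence.from ∘ N[T]≐N[T′]))
               (Odd-nbhd⊆⇒⊇ m≡k+[1+k] T′ T (Equivalence.to ∘ N[T]≐N[T′])))
    ; surj = λ T → T , λ u → mk⇔ id id
    }

  incidence : ∀ S T → (S D.I T) ⇔ (φ S N.I T)
  incidence S T = ⊆⇔disjoint-∁ ⇔-∘ Meet⊆Meet⇔⊇ (point-size≤ S)

open import Data.Nat using (_*_)

-- The hypothesis that the forms Hᵢ are nonzero already follows from general position.
theorem3p4 : ∀ {c ℓ} (F : CommutativeRing c ℓ) → IsField F →
    (n : ℕ) → 2 ≤ n →
    (H : Fin (2 * n ∸ 1) → Fin (suc n) → CommutativeRing.Carrier F) →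
    (∀ i → ¬ Projective.IsZeroVec F (H i)) →
    Projective.GeneralPosition F H →
    Projective.DCD F n H ≅ NCon (Odd n)
theorem3p4 F isField (suc k) (s≤s 1≤k) H _ general = record
  { φ     = φ
  ; ψ     = id
  ; φ-bij = φ-bij
  ; ψ-bij = ψ-bij
  ; inc   = incidence
  }
  where open DCD≅NOdd F isField k 1≤k H general
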